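{- Let $G$ be a finite simple undirected graph, let $d \ge 0$ be an integer, and let $U$ and $U'$ be $d$-regular sets of $G$. If $U \leftrightarrow U'$ under $\mathsf{TJ}$ or under $\mathsf{TS}$, then the induced subgraphs $G[U]$ and $G[U']$ are isomorphic.
   Context: For a vertex subset $U$ of a graph $G$, $G[U]$ denotes the subgraph induced by $U$. A vertex subset $U$ is a $d$-regular set of $G$ if every vertex of $G[U]$ has degree exactly $d$ in $G[U]$. For two $d$-regular sets $U, U'$ of $G$: $U \leftrightarrow U'$ under $\mathsf{TJ}$ (Token Jumping) if $|U \setminus U'| = |U' \setminus U| = 1$; and $U \leftrightarrow U'$ under $\mathsf{TS}$ (Token Sliding) if $U \setminus U' = \{v\}$, $U' \setminus U = \{w\}$ and $vw \in E(G)$. -}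

module Defs where

open import Data.Nat using (ℕ)
open import Data.Bool using (Bool; true; false; T)
open import Data.Fin using (Fin)
open import Data.Fin.Subset using (Subset; _∈_; _∉_; ∣_∣; _∩_)
open import Data.Vec using (tabulate)
open import Data.Product using (Σ; _×_; _,_; proj₁; ∃)
open import Data.Empty using (⊥)
open import Relation.Nullary using (¬_)
open import Relation.Binary.PropositionalEquality using (_≡_)
open import Function.Bundles using (_⤖_; Func)
open import Level using (0ℓ)

record Graph (n : ℕ) : Set where
  field
    adj   : Fin n → Fin n → Bool
    sym   : ∀ u v → adj u v ≡ adj v u
    irrefl : ∀ v → adj v v ≡ false

open Graph public

_∼[_]_ : ∀ {n} → Fin n → Graph n → Fin n → Set
u ∼[ G ] v = T (adj G u v)

N : ∀ {n} → Graph n → Fin n → Subset n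
N G v = tabulate (adj G v)

degIn : ∀ {n} → Graph n → Subset n → Fin n → ℕ
degIn G U v = ∣ N G v ∩ U ∣

IsRegularSet : ∀ {n} → Graph n → ℕ → Subset n → Set
IsRegularSet G d U = ∀ v → v ∈ U → degIn G U v ≡ d

DiffIsSingleton : ∀ {n} → Subset n → Subset n → Fin n → Set
DiffIsSingleton U U' v = ∀ x → (x ∈ U × x ∉ U') ⇔' (x ≡ v)
  where
  _⇔'_ : Set → Set → Set
  A ⇔' B = (A → B) × (B → A)

TJ : ∀ {n} → Graph n → Subset n → Subset n → Set
TJ G U U' = Σ _ λ v → Σ _ λ w → DiffIsSingleton U U' v × DiffIsSingleton U' U w

TS : ∀ {n} → Graph n → Subset n → Subset n → Set
TS G U U' = Σ _ λ v → Σ _ λ w →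
  DiffIsSingleton U U' v × DiffIsSingleton U' U w × (v ∼[ G ] w)

Vtx : ∀ {n} → Subset n → Set
Vtx {n} U = Σ (Fin n) λ v → v ∈ U

record InducedIso {n} (G : Graph n) (U U' : Subset n) : Set where
  field
    to      : Vtx U → Vtx U'
    from    : Vtx U' → Vtx U
    from∘to : ∀ x → proj₁ (from (to x)) ≡ proj₁ x
    to∘from : ∀ y → proj₁ (to (from y)) ≡ proj₁ y
    preserves : ∀ x y → adj G (proj₁ x) (proj₁ y) ≡ adj G (proj₁ (to x)) (proj₁ (to y))

-- Write U = C ∪ {v} and U' = C ∪ {w}. A vertex y ∈ C has degree d in both G[U] and G[U'],
-- and its two neighbourhoods agree on C, so y ∼ v exactly when y ∼ w. Hence the
-- transposition of v and w is an isomorphism G[U] ≅ G[U'].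
module Submission where

open import Defs hiding (sym)
open import Data.Nat using (ℕ; suc)
open import Data.Nat.Properties using (<-irrefl; n<1+n)
open import Data.Bool using (true)
open import Data.Bool.Properties using (⇔→≡)
open import Data.Fin using (Fin; zero; suc; _≟_)
open import Data.Fin.Permutation.Components using (transpose; transpose-inverse)
open import Data.Fin.Subset using (Subset; _∈_; _∉_; _⊆_; ∣_∣; _∩_; _-_; ⁅_⁆; inside; outside)
open import Data.Fin.Subset.Properties
  using (_∈?_; ⊆-antisym; p─q⊆p; p─⊥≡p; x∈p∧x≢y⇒x∈p-y; x∈p∩q⁺; x∈p∩q⁻)
open import Data.Vec using (_∷_; here; there)
open import Data.Vec.Properties using ([]=⇒lookup; lookup⇒[]=; lookup∘tabulate)
open import Data.Product using (_,_; proj₁; proj₂)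
open import Data.Sum using (_⊎_; inj₁; inj₂)
open import Function.Bundles using (_⇔_; mk⇔; Equivalence)
open import Relation.Nullary using (Dec; yes; no; contradiction)
open import Relation.Nullary.Decidable using (dec-true; dec-false)
open import Relation.Binary.PropositionalEquality

private
  variable
    n : ℕ
    p q : Subset n
    i j v w x y : Fin n
    U U' : Subset n
    G : Graph n
    d : ℕ

x∉p-x : x ∉ p - x
x∉p-x {x = zero}  {p = _ ∷ _} ()
x∉p-x {x = suc x} {p = _ ∷ _} (there x∈p-x) = x∉p-x x∈p-x

x∈p-y⇒x≢y : x ∈ p - y → x ≢ y
x∈p-y⇒x≢y x∈p-y refl = x∉p-x x∈p-y

x∉p⇒p-x≡p : x ∉ p → p - x ≡ p
x∉p⇒p-x≡p {x = x} {p = p} x∉p =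
  ⊆-antisym (p─q⊆p p ⁅ x ⁆) (λ y∈p → x∈p∧x≢y⇒x∈p-y y∈p λ { refl → x∉p y∈p })

x∈p⇒∣p∣≡1+∣p-x∣ : x ∈ p → ∣ p ∣ ≡ suc ∣ p - x ∣
x∈p⇒∣p∣≡1+∣p-x∣ {p = inside ∷ p} here = cong (λ r → suc ∣ r ∣) (sym (p─⊥≡p p))
x∈p⇒∣p∣≡1+∣p-x∣ {p = inside  ∷ _} (there x∈p) = cong suc (x∈p⇒∣p∣≡1+∣p-x∣ x∈p)
x∈p⇒∣p∣≡1+∣p-x∣ {p = outside ∷ _} (there x∈p) = x∈p⇒∣p∣≡1+∣p-x∣ x∈p

∣p∣≡∣q∣⇒p-x≡q-y⇒x∈p⇒y∈q : ∣ p ∣ ≡ ∣ q ∣ → p - x ≡ q - y → x ∈ p → y ∈ q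
∣p∣≡∣q∣⇒p-x≡q-y⇒x∈p⇒y∈q {p = p} {q = q} {x = x} {y = y} ∣p∣≡∣q∣ p-x≡q-y x∈p with y ∈? q
... | yes y∈q = y∈q
... | no  y∉q = contradiction (n<1+n ∣ p - x ∣) (<-irrefl ∣p-x∣≡1+∣p-x∣)
  where
  open ≡-Reasoning
  ∣p-x∣≡1+∣p-x∣ : ∣ p - x ∣ ≡ suc ∣ p - x ∣
  ∣p-x∣≡1+∣p-x∣ = begin
    ∣ p - x ∣      ≡⟨ cong ∣_∣ p-x≡q-y ⟩
    ∣ q - y ∣      ≡⟨ cong ∣_∣ (x∉p⇒p-x≡p y∉q) ⟩
    ∣ q ∣          ≡⟨ sym ∣p∣≡∣q∣ ⟩
    ∣ p ∣          ≡⟨ x∈p⇒∣p∣≡1+∣p-x∣ x∈p ⟩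
    suc ∣ p - x ∣  ∎

transpose-≡ : ∀ (i j : Fin n) → transpose i j i ≡ j
transpose-≡ i j rewrite dec-true (i ≟ i) refl = refl

transpose-≢ : x ≢ i → x ≢ j → transpose i j x ≡ x
transpose-≢ {x = x} {i} {j} x≢i x≢j
  rewrite dec-false (x ≟ i) x≢i | dec-false (x ≟ j) x≢j = refl

∈N⇔adj≡true : ∀ (G : Graph n) → x ∈ N G y ⇔ adj G y x ≡ true
∈N⇔adj≡true {x = x} {y} G = mk⇔
  (λ x∈N → trans (sym (lookup∘tabulate (adj G y) x)) ([]=⇒lookup x∈N))
  (λ y∼x → lookup⇒[]= x (N G y) (trans (lookup∘tabulate (adj G y) x) y∼x))

module Exchange {n} {U U' : Subset n} {v w : Fin n}
  (U─U'≡v : DiffIsSingleton U U' v) (U'─U≡w : DiffIsSingleton U' U w) where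

  v∈U : v ∈ U
  v∈U = proj₁ (proj₂ (U─U'≡v v) refl)

  w∈U' : w ∈ U'
  w∈U' = proj₁ (proj₂ (U'─U≡w w) refl)

  ∈U⇒≢w : x ∈ U → x ≢ w
  ∈U⇒≢w x∈U refl = proj₂ (proj₂ (U'─U≡w w) refl) x∈U

  ∈U⇒≢v⇒∈U' : x ∈ U → x ≢ v → x ∈ U'
  ∈U⇒≢v⇒∈U' {x = x} x∈U x≢v with x ∈? U'
  ... | yes x∈U' = x∈U'
  ... | no  x∉U' = contradiction (proj₁ (U─U'≡v x) (x∈U , x∉U')) x≢v

  transpose-fixes : x ∈ U → x ≢ v → transpose v w x ≡ x
  transpose-fixes x∈U x≢v = transpose-≢ x≢v (∈U⇒≢w x∈U)

  transpose-∈ : x ∈ U → transpose v w x ∈ U'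
  -- Splitting with `with x ≟ v` would also abstract the identical test inside transpose.
  transpose-∈ {x = x} x∈U = by-cases (x ≟ v)
    where
    by-cases : Dec (x ≡ v) → transpose v w x ∈ U'
    by-cases (yes refl) = subst (_∈ U') (sym (transpose-≡ v w)) w∈U'
    by-cases (no x≢v)   = subst (_∈ U') (sym (transpose-fixes x∈U x≢v)) (∈U⇒≢v⇒∈U' x∈U x≢v)

  p∩U-v⊆p∩U'-w : ∀ (p : Subset n) → p ∩ U - v ⊆ p ∩ U' - w
  p∩U-v⊆p∩U'-w p {z} z∈p∩U-v =
    x∈p∧x≢y⇒x∈p-y (x∈p∩q⁺ (z∈p , ∈U⇒≢v⇒∈U' z∈U z≢v)) (∈U⇒≢w z∈U)
    where
    z≢v = x∈p-y⇒x≢y z∈p∩U-v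
    z∈p∩U = p─q⊆p (p ∩ U) ⁅ v ⁆ z∈p∩U-v
    z∈p = proj₁ (x∈p∩q⁻ p U z∈p∩U)
    z∈U = proj₂ (x∈p∩q⁻ p U z∈p∩U)

adj-transfer : ∀ (G : Graph n) → IsRegularSet G d U → IsRegularSet G d U' →
               DiffIsSingleton U U' v → DiffIsSingleton U' U w →
               y ∈ U → y ≢ v → adj G y v ≡ true → adj G y w ≡ true
adj-transfer {U = U} {U' = U'} {v = v} {w = w} {y = y} G regU regU' U─U'≡v U'─U≡w y∈U y≢v y∼v =
  Equivalence.to (∈N⇔adj≡true G) (proj₁ (x∈p∩q⁻ (N G y) U' w∈N∩U'))
  where
  open Exchange U─U'≡v U'─U≡w
  N∩U-v≡N∩U'-w : N G y ∩ U - v ≡ N G y ∩ U' - w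
  N∩U-v≡N∩U'-w = ⊆-antisym (p∩U-v⊆p∩U'-w (N G y)) (Exchange.p∩U-v⊆p∩U'-w U'─U≡w U─U'≡v (N G y))
  w∈N∩U' : w ∈ N G y ∩ U'
  w∈N∩U' = ∣p∣≡∣q∣⇒p-x≡q-y⇒x∈p⇒y∈q
    (trans (regU y y∈U) (sym (regU' y (∈U⇒≢v⇒∈U' y∈U y≢v))))
    N∩U-v≡N∩U'-w
    (x∈p∩q⁺ (Equivalence.from (∈N⇔adj≡true G) y∼v , v∈U))

adj-exchange : ∀ (G : Graph n) → IsRegularSet G d U → IsRegularSet G d U' →
               DiffIsSingleton U U' v → DiffIsSingleton U' U w →
               y ∈ U → y ≢ v → adj G y v ≡ adj G y w
adj-exchange G regU regU' U─U'≡v U'─U≡w y∈U y≢v = ⇔→≡ (mk⇔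
  (adj-transfer G regU regU' U─U'≡v U'─U≡w y∈U y≢v)
  (adj-transfer G regU' regU U'─U≡w U─U'≡v (∈U⇒≢v⇒∈U' y∈U y≢v) (∈U⇒≢w y∈U)))
  where open Exchange U─U'≡v U'─U≡w

transposition-iso : IsRegularSet G d U → IsRegularSet G d U' →
                    DiffIsSingleton U U' v → DiffIsSingleton U' U w →
                    InducedIso G U U'
transposition-iso {G = G} {U = U} {v = v} {w = w} regU regU' U─U'≡v U'─U≡w = record
  { to        = λ (x , x∈U) → transpose v w x , transpose-∈ x∈U
  ; from      = λ (y , y∈U') → transpose w v y , Exchange.transpose-∈ U'─U≡w U─U'≡v y∈U'
  ; from∘to   = λ _ → transpose-inverse w v
  ; to∘from   = λ _ → transpose-inverse v w
  ; preserves = λ (x , x∈U) (y , y∈U) → adj-preserved x∈U y∈U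
  }
  where
  open Exchange U─U'≡v U'─U≡w
  exchange : y ∈ U → y ≢ v → adj G y v ≡ adj G y w
  exchange = adj-exchange G regU regU' U─U'≡v U'─U≡w
  adj-preserved : x ∈ U → y ∈ U → adj G x y ≡ adj G (transpose v w x) (transpose v w y)
  adj-preserved {x = x} {y = y} x∈U y∈U = by-cases (x ≟ v) (y ≟ v)
    where
    by-cases : Dec (x ≡ v) → Dec (y ≡ v) → adj G x y ≡ adj G (transpose v w x) (transpose v w y)
    by-cases (yes refl) (yes refl) rewrite transpose-≡ v w =
      trans (irrefl G v) (sym (irrefl G w))
    by-cases (yes refl) (no y≢v) rewrite transpose-≡ v w | transpose-fixes y∈U y≢v =
      trans (Graph.sym G v y) (trans (exchange y∈U y≢v) (Graph.sym G y w))
    by-cases (no x≢v) (yes refl) rewrite transpose-≡ v w | transpose-fixes x∈U x≢v =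
      exchange x∈U x≢v
    by-cases (no x≢v) (no y≢v) rewrite transpose-fixes x∈U x≢v | transpose-fixes y∈U y≢v =
      refl

lemma1 : ∀ {n} (G : Graph n) (d : ℕ) (U U' : Subset n) →
    IsRegularSet G d U → IsRegularSet G d U' →
    TJ G U U' ⊎ TS G U U' →
    InducedIso G U U'
lemma1 G d U U' regU regU' (inj₁ (_ , _ , U─U'≡v , U'─U≡w)) =
  transposition-iso regU regU' U─U'≡v U'─U≡w
lemma1 G d U U' regU regU' (inj₂ (_ , _ , U─U'≡v , U'─U≡w , _)) =
  transposition-iso regU regU' U─U'≡v U'─U≡w
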